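{- Let $\mathcal M$ be a stack machine with $k$ states. Then in the run of $\mathcal M$ from the configuration $(q_{\mathrm i},0^{k+2})$ there is a word of $\{0,1\}^{k+2}$ that is never the current word of any configuration of the run.
   Context: A stack machine is a tuple $\mathcal M=(Q,q_{\mathrm i},q_{\mathrm h},Q_{\mathrm O},\delta)$ with $Q$ a finite set of states, initial state $q_{\mathrm i}$, halting state $q_{\mathrm h}$, output states $Q_{\mathrm O}$, and $\delta\colon (Q\setminus\{q_{\mathrm h}\})\times\{0,1,\triangleright\}\to Q\times(\{\mathrm{pop}\}\cup(\{\mathrm{push}\}\times\{0,1\}))$. A configuration is a pair $(q,w)$ with $w$ a binary word (possibly empty). Based on the state and the rightmost bit of $w$ (or $\triangleright$ if $w$ is empty), the machine changes state and either deletes the rightmost bit of $w$ (pop; no effect on the empty word) or appends a given bit to the right of $w$ (push). The run stops when $q_{\mathrm h}$ is reached. A word is visited if it is the current word of some configuration of the run. -}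

module Defs where

open import Data.Nat using (ℕ; zero; suc)
open import Data.Fin using (Fin; _≟_)
open import Data.Fin.Subset using (Subset)
open import Data.List using (List; []; _∷_; _∷ʳ_; unsnoc)
open import Data.Maybe using (Maybe; just; nothing)
open import Data.Product using (_×_; _,_; proj₁; proj₂)
open import Relation.Binary.PropositionalEquality using (_≢_)
open import Relation.Nullary using (yes; no)

data Bit : Set where
  b0 b1 : Bit

-- Symbols read by the transition function: a bit, or ▷ for the empty word.
data Symbol : Set where
  bit : Bit → Symbol
  ▷   : Symbol

data Action : Set where
  pop  : Action
  push : Bit → Action

record StackMachine (k : ℕ) : Set where
  field
    qi : Fin k
    qh : Fin k
    QO : Subset k
    δ  : (q : Fin k) → q ≢ qh → Symbol → Fin k × Action

-- Words are binary lists read left to right; the rightmost bit is the last element.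
Word : Set
Word = List Bit

Config : ℕ → Set
Config k = Fin k × Word

rightmost : Word → Symbol
rightmost w with unsnoc w
... | nothing      = ▷
... | just (_ , b) = bit b

popWord : Word → Word
popWord w with unsnoc w
... | nothing       = []
... | just (u , _)  = u

apply : Action → Word → Word
apply pop      w = popWord w
apply (push b) w = w ∷ʳ b

-- One step of the run; a configuration in the halting state is left unchanged
-- (the run has stopped, so no new configurations arise).
step : ∀ {k} → StackMachine k → Config k → Config k
step M (q , w) with q ≟ StackMachine.qh M
... | yes _   = (q , w)
... | no q≢qh with StackMachine.δ M q q≢qh (rightmost w)
...   | (q' , a) = (q' , apply a w)

run : ∀ {k} → StackMachine k → Config k → ℕ → Config k
run M c zero    = c
run M c (suc n) = step M (run M c n)

Visited : ∀ {k} → StackMachine k → Config k → Word → Set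
Visited M c w = Data.Product.∃ λ n → proj₂ (run M c n) Relation.Binary.PropositionalEquality.≡ w

{-# OPTIONS --safe #-}
-- For c ∈ {0, 1} let w_c = 1 c^(k+1). To visit w_c the machine must first pop the bottom 0 of the initial
-- word; afterwards, for each height d = 2, …, k + 2, the word at the last time before the visit at which the
-- height is d is the prefix of w_c of length d, so its top symbol is c. Two of these k + 1 times share a state.
-- A step depends only on the state and the top symbol, so the run between them repeats for ever on a stack
-- that keeps growing, and the prefix 1c is never popped again. Hence w_0 and w_1 are not both visited.
-- To name an unvisited word constructively, visiting is decided: either the height reaches height 0 + 3k,
-- which yields such a pump and hence a bound on the time of any visit, or a configuration repeats early.
module Submission where

open import Defs
open import Data.Empty using (⊥-elim)
open import Data.Fin as Fin using (Fin; toℕ; fromℕ<; _≟_)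
open import Data.Fin.Properties using (toℕ<n; toℕ-injective; toℕ-fromℕ<; pigeonhole)
open import Data.List as List using (List; []; _∷_; _∷ʳ_; _++_; length; initLast; _∷ʳ′_)
open import Data.List.Properties
  using ( ≡-dec; ++-assoc; ++-identityʳ; ++-identityʳ-unique; ++-cancelˡ; length-++; length-++-≤ˡ
        ; length-replicate; ∷-injective; ∷-injectiveˡ; ∷-injectiveʳ)
open import Data.List.Relation.Unary.All using (All)
open import Data.List.Relation.Unary.All.Properties using (++⁻ˡ; ∷ʳ⁻; replicate⁺)
open import Data.Maybe using (Maybe; just; nothing)
open import Data.Nat
  using ( ℕ; zero; suc; _+_; _*_; _∸_; _^_; _≤_; _<_; z≤n; s≤s; z<s; s≤s⁻¹; _≤?_; _<?_
        ; NonZero; ≢-nonZero; >-nonZero)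
open import Data.Nat.DivMod using (_/_; _%_; m≡m%n+[m/n]*n; m%n<n; [m+kn]%n≡m%n; m<n⇒m%n≡m)
open import Data.Nat.Induction using (<-rec)
open import Data.Nat.Properties hiding (_≟_; _≤?_; _<?_)
open import Data.Product using (∃; ∃₂; _×_; _,_; proj₁; proj₂)
open import Data.Sum using (_⊎_; inj₁; inj₂)
open import Data.Vec using (Vec; toList; fromList; replicate)
open import Data.Vec.Properties using (toList∘fromList; toList-replicate)
open import Function using (_∘_)
open import Relation.Binary.PropositionalEquality
open import Relation.Nullary using (¬_; Dec; yes; no)

initLast-∷ʳ : ∀ {A : Set} (xs : List A) x → initLast (xs ∷ʳ x) ≡ xs ∷ʳ′ x
initLast-∷ʳ []       x = refl
initLast-∷ʳ (y ∷ ys) x rewrite initLast-∷ʳ ys x = refl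

rightmost-∷ʳ : ∀ w b → rightmost (w ∷ʳ b) ≡ bit b
rightmost-∷ʳ w b rewrite initLast-∷ʳ w b = refl

popWord-∷ʳ : ∀ w b → popWord (w ∷ʳ b) ≡ w
popWord-∷ʳ w b rewrite initLast-∷ʳ w b = refl

++-∷ʳ : ∀ (u w : Word) b → u ++ w ∷ʳ b ≡ (u ++ w) ∷ʳ b
++-∷ʳ u w b = sym (++-assoc u w (b ∷ []))

rightmost-++ : ∀ u v z → rightmost u ≡ rightmost v → rightmost (u ++ z) ≡ rightmost (v ++ z)
rightmost-++ u v z eq with initLast z
... | []       rewrite ++-identityʳ u | ++-identityʳ v = eq
... | zs ∷ʳ′ b rewrite ++-∷ʳ u zs b | ++-∷ʳ v zs b
                     | rightmost-∷ʳ (u ++ zs) b | rightmost-∷ʳ (v ++ zs) b = refl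

length-popWord : ∀ w → length (popWord w) ≤ length w
length-popWord w with initLast w
... | []       = z≤n
... | ws ∷ʳ′ b rewrite length-++ ws {b ∷ []} = m≤m+n _ 1

_≟ᵇ_ : (b b' : Bit) → Dec (b ≡ b')
b0 ≟ᵇ b0 = yes refl
b0 ≟ᵇ b1 = no λ ()
b1 ≟ᵇ b0 = no λ ()
b1 ≟ᵇ b1 = yes refl

infix 4 _≼_

_≼_ : Word → Word → Set
u ≼ w = ∃ λ z → w ≡ u ++ z

≼-trans : ∀ {u v w} → u ≼ v → v ≼ w → u ≼ w
≼-trans {u} (z , refl) (z' , refl) = z ++ z' , ++-assoc u z z'

-- nothing stands for a step in the halting state, which leaves the word unchanged.
act : Maybe Action → Word → Word
act nothing  w = w
act (just a) w = apply a w

length-act : ∀ m w → length (act m w) ≤ suc (length w)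
length-act nothing         w = n≤1+n _
length-act (just pop)      w = m≤n⇒m≤1+n (length-popWord w)
length-act (just (push b)) w = ≤-reflexive (trans (length-++ w) (+-comm (length w) 1))

act-++ : ∀ m u z → length u < length (act m (u ++ z)) → ∀ v → act m (v ++ z) ≡ v ++ act m z
act-++ nothing         u z _ v = refl
act-++ (just (push b)) u z _ v = sym (++-∷ʳ v z b)
act-++ (just pop)      u z u<h v with initLast z
... | zs ∷ʳ′ b rewrite ++-∷ʳ v zs b | popWord-∷ʳ (v ++ zs) b = refl
... | []       rewrite ++-identityʳ u = ⊥-elim (<⇒≱ u<h (length-popWord u))

≤-suc-elim : ∀ {P : ℕ → Set} {T} → (∀ t → t ≤ T → P t) → P (suc T) → ∀ t → t ≤ suc T → P t
≤-suc-elim below top t t≤1+T with m≤n⇒m<n∨m≡n t≤1+T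
... | inj₁ t<1+T = below t (s≤s⁻¹ t<1+T)
... | inj₂ refl  = top

lastUpTo : ∀ {P : ℕ → Set} → (∀ t → Dec (P t)) → ∀ T →
  (∀ t → t ≤ T → ¬ P t) ⊎ ∃ λ σ → σ ≤ T × P σ × (∀ r → r ≤ T → σ < r → ¬ P r)
lastUpTo P? zero with P? zero
... | yes p = inj₂ (0 , z≤n , p , λ r r≤0 0<r → ⊥-elim (<⇒≱ 0<r r≤0))
... | no ¬p = inj₁ λ { zero _ → ¬p }
lastUpTo P? (suc T) with P? (suc T)
... | yes p = inj₂ (suc T , ≤-refl , p , λ r r≤1+T 1+T<r → ⊥-elim (<⇒≱ 1+T<r r≤1+T))
... | no ¬p with lastUpTo P? T
...   | inj₁ none                  = inj₁ (≤-suc-elim none ¬p)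
...   | inj₂ (σ , σ≤T , p , after) = inj₂ (σ , m≤n⇒m≤1+n σ≤T , p , ≤-suc-elim after (λ _ → ¬p))

pigeonhole-ℕ : ∀ n (f : Fin (suc n) → ℕ) → (∀ i → f i < n) → ∃₂ λ i j → i Fin.< j × f i ≡ f j
pigeonhole-ℕ n f f<n with pigeonhole (n<1+n n) (λ i → fromℕ< (f<n i))
... | i , j , i<j , eq = i , j , i<j , (begin
      f i               ≡⟨ toℕ-fromℕ< (f<n i) ⟨
      toℕ (fromℕ< _)    ≡⟨ cong toℕ eq ⟩
      toℕ (fromℕ< _)    ≡⟨ toℕ-fromℕ< (f<n j) ⟩
      f j               ∎)
  where open ≡-Reasoning

digits-injective : ∀ {n a a' b b'} → b < n → b' < n → b + a * n ≡ b' + a' * n → b ≡ b' × a ≡ a'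
digits-injective {n} {a} {a'} {b} {b'} b<n b'<n eq =
  b≡b' , *-cancelʳ-≡ a a' n (+-cancelˡ-≡ b _ _ (trans eq (cong (_+ a' * n) (sym b≡b'))))
  where
  instance
    n-nonZero : NonZero n
    n-nonZero = >-nonZero (<-≤-trans z<s b<n)
  open ≡-Reasoning
  b≡b' : b ≡ b'
  b≡b' = begin
    b                  ≡⟨ m<n⇒m%n≡m b<n ⟨
    b % n              ≡⟨ [m+kn]%n≡m%n b a n ⟨
    (b + a * n) % n    ≡⟨ cong (_% n) eq ⟩
    (b' + a' * n) % n  ≡⟨ [m+kn]%n≡m%n b' a' n ⟩
    b' % n             ≡⟨ m<n⇒m%n≡m b'<n ⟩
    b'                 ∎

bitCode : Bit → ℕ
bitCode b0 = 0
bitCode b1 = 1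

bitCode<2 : ∀ b → bitCode b < 2
bitCode<2 b0 = s≤s z≤n
bitCode<2 b1 = s≤s (s≤s z≤n)

bitCode-injective : ∀ b b' → bitCode b ≡ bitCode b' → b ≡ b'
bitCode-injective b0 b0 _ = refl
bitCode-injective b1 b1 _ = refl
bitCode-injective b0 b1 ()
bitCode-injective b1 b0 ()

symbolCode : Symbol → ℕ
symbolCode (bit b) = bitCode b
symbolCode ▷       = 2

symbolCode<3 : ∀ s → symbolCode s < 3
symbolCode<3 (bit b) = m<n⇒m<1+n (bitCode<2 b)
symbolCode<3 ▷       = ≤-refl

symbolCode-injective : ∀ s s' → symbolCode s ≡ symbolCode s' → s ≡ s'
symbolCode-injective (bit b)  (bit b') eq = cong bit (bitCode-injective b b' eq)
symbolCode-injective ▷        ▷        _  = refl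
symbolCode-injective (bit b0) ▷        ()
symbolCode-injective (bit b1) ▷        ()
symbolCode-injective ▷        (bit b0) ()
symbolCode-injective ▷        (bit b1) ()

-- Binary notation with a leading 1, so that words of different lengths get different codes.
wordCode : Word → ℕ
wordCode []      = 1
wordCode (b ∷ w) = bitCode b + wordCode w * 2

wordCode-positive : ∀ w → 0 < wordCode w
wordCode-positive []      = z<s
wordCode-positive (b ∷ w) =
  <-≤-trans (wordCode-positive w) (≤-trans (m≤m*n (wordCode w) 2) (m≤n+m _ (bitCode b)))

wordCode< : ∀ w → wordCode w < 2 ^ suc (length w)
wordCode< []      = s≤s (s≤s z≤n)
wordCode< (b ∷ w) = begin-strict
  bitCode b + wordCode w * 2   <⟨ +-monoˡ-< (wordCode w * 2) (bitCode<2 b) ⟩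
  suc (wordCode w) * 2         ≤⟨ *-monoˡ-≤ 2 (wordCode< w) ⟩
  2 ^ suc (length w) * 2       ≡⟨ *-comm (2 ^ suc (length w)) 2 ⟩
  2 ^ suc (length (b ∷ w))     ∎
  where open ≤-Reasoning

wordCode-injective : ∀ w w' → wordCode w ≡ wordCode w' → w ≡ w'
wordCode-injective []      []       _  = refl
wordCode-injective []      (b ∷ w') eq =
  ⊥-elim (<⇒≢ (wordCode-positive w') (proj₂ (digits-injective {2} {0} {b = 1} ≤-refl (bitCode<2 b) eq)))
wordCode-injective (b ∷ w) []       eq =
  ⊥-elim (<⇒≢ (wordCode-positive w) (sym (proj₂ (digits-injective {2} {b' = 1} (bitCode<2 b) ≤-refl eq))))
wordCode-injective (b ∷ w) (b' ∷ w') eq with digits-injective (bitCode<2 b) (bitCode<2 b') eq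
... | b≡b' , w≡w' = cong₂ _∷_ (bitCode-injective b b' b≡b') (wordCode-injective w w' w≡w')

topCode : ∀ {k} → Config k → ℕ
topCode (q , w) = symbolCode (rightmost w) + toℕ q * 3

topCode< : ∀ {k} (c : Config k) → topCode c < k * 3
topCode< (q , w) = <-≤-trans (+-monoˡ-< (toℕ q * 3) (symbolCode<3 (rightmost w))) (*-monoˡ-≤ 3 (toℕ<n q))

topCode-injective : ∀ {k} (c c' : Config k) → topCode c ≡ topCode c' →
  proj₁ c ≡ proj₁ c' × rightmost (proj₂ c) ≡ rightmost (proj₂ c')
topCode-injective (q , w) (q' , w') eq
  with digits-injective (symbolCode<3 (rightmost w)) (symbolCode<3 (rightmost w')) eq
... | s≡s' , q≡q' = toℕ-injective q≡q' , symbolCode-injective _ _ s≡s'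

configCode : ∀ {k} → Config k → ℕ
configCode {k} (q , w) = toℕ q + wordCode w * k

configCode< : ∀ {k} H (c : Config k) → length (proj₂ c) < H → configCode c < 2 ^ H * k
configCode< {k} H (q , w) |w|<H =
  <-≤-trans (+-monoˡ-< (wordCode w * k) (toℕ<n q)) (*-monoˡ-≤ k (≤-trans (wordCode< w) (^-monoʳ-≤ 2 |w|<H)))

configCode-injective : ∀ {k} (c c' : Config k) → configCode c ≡ configCode c' → c ≡ c'
configCode-injective (q , w) (q' , w') eq with digits-injective (toℕ<n q) (toℕ<n q') eq
... | q≡q' , w≡w' = cong₂ _,_ (toℕ-injective q≡q') (wordCode-injective w w' w≡w')

module _ {k : ℕ} (M : StackMachine k) where
  open StackMachine M

  run-+ : ∀ c m n → run M c (m + n) ≡ run M (run M c m) n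
  run-+ c m zero    = cong (run M c) (+-identityʳ m)
  run-+ c m (suc n) = trans (cong (run M c) (+-suc m n)) (cong (step M) (run-+ c m n))

  step-uniform : ∀ q s → ∃₂ λ q' m → ∀ w → rightmost w ≡ s → step M (q , w) ≡ (q' , act m w)
  step-uniform q s with q ≟ qh
  ... | yes _   = q , nothing , λ _ _ → refl
  ... | no q≢qh = proj₁ (δ q q≢qh s) , just (proj₂ (δ q q≢qh s)) , λ { w refl → refl }

  length-step : ∀ c → length (proj₂ (step M c)) ≤ suc (length (proj₂ c))
  length-step (q , w) with step-uniform q (rightmost w)
  ... | q' , m , step≡ rewrite step≡ w refl = length-act m w

  step-above : ∀ q u z → length u < length (proj₂ (step M (q , u ++ z))) →
    ∃₂ λ q' z' → ∀ v → rightmost v ≡ rightmost u → step M (q , v ++ z) ≡ (q' , v ++ z')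
  step-above q u z grows with step-uniform q (rightmost (u ++ z))
  ... | q' , m , step≡ = q' , act m z , λ v top →
    trans (step≡ (v ++ z) (rightmost-++ v u z top))
          (cong (q' ,_) (act-++ m u z (subst (λ c → length u < length (proj₂ c)) (step≡ (u ++ z) refl) grows) v))

  -- While the word stays longer than u, the run never reads below the top symbol of u.
  run-above : ∀ n q u z₀ → (∀ r → 0 < r → r ≤ n → length u < length (proj₂ (run M (q , u ++ z₀) r))) →
    ∃₂ λ q' z → ∀ v → rightmost v ≡ rightmost u → run M (q , v ++ z₀) n ≡ (q' , v ++ z)
  run-above zero    q u z₀ _     = q , z₀ , λ _ _ → refl
  run-above (suc n) q u z₀ above with run-above n q u z₀ (λ r 0<r r≤n → above r 0<r (m≤n⇒m≤1+n r≤n))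
  ... | qₙ , zₙ , runₙ
    with step-above qₙ u zₙ
           (subst (λ c → length u < length (proj₂ (step M c))) (runₙ u refl) (above (suc n) z<s ≤-refl))
  ...   | q' , z' , stepₙ = q' , z' , λ v top → trans (cong (step M) (runₙ v top)) (stepₙ v top)

  module Run (c₀ : Config k) where

    R : ℕ → Config k
    R = run M c₀

    state : ℕ → Fin k
    state t = proj₁ (R t)

    word : ℕ → Word
    word t = proj₂ (R t)

    height : ℕ → ℕ
    height t = length (word t)

    run-from : ∀ a n {w} → word a ≡ w → R (a + n) ≡ run M (state a , w) n
    run-from a n eq = trans (run-+ c₀ a n) (cong (λ w → run M (state a , w) n) eq)

    prefix-persists : ∀ a n {u} → u ≼ word a → (∀ r → 0 < r → r ≤ n → length u < height (a + r)) →
      u ≼ word (a + n)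
    prefix-persists a n {u} (z₀ , eq) above with run-above n (state a) u z₀ above-from-a
      where
      above-from-a : ∀ r → 0 < r → r ≤ n → length u < length (proj₂ (run M (state a , u ++ z₀) r))
      above-from-a r 0<r r≤n = subst (λ c → length u < length (proj₂ c)) (run-from a r eq) (above r 0<r r≤n)
    ... | _ , z , run≡ = z , cong proj₂ (trans (run-from a n eq) (run≡ u refl))

    repetition-bound : ∀ {s t} → s < t → R s ≡ R t → ∀ x → ∃ λ x' → x' < t × R x ≡ R x'
    repetition-bound {s} {t} s<t Rs≡Rt = <-rec _ earlier
      where
      earlier : ∀ x → (∀ {y} → y < x → ∃ λ x' → x' < t × R y ≡ R x') → ∃ λ x' → x' < t × R x ≡ R x'
      earlier x rec with x <? t
      ... | yes x<t = x , x<t , refl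
      ... | no x≮t with rec (subst (s + (x ∸ t) <_) (m+[n∸m]≡n (≮⇒≥ x≮t)) (+-monoˡ-< (x ∸ t) s<t))
      ...   | x' , x'<t , Ry≡Rx' = x' , x'<t , (begin
              R x                      ≡⟨ cong R (m+[n∸m]≡n (≮⇒≥ x≮t)) ⟨
              R (t + (x ∸ t))          ≡⟨ run-+ c₀ t (x ∸ t) ⟩
              run M (R t) (x ∸ t)      ≡⟨ cong (λ c → run M c (x ∸ t)) Rs≡Rt ⟨
              run M (R s) (x ∸ t)      ≡⟨ run-+ c₀ s (x ∸ t) ⟨
              R (s + (x ∸ t))          ≡⟨ Ry≡Rx' ⟩
              R x'                     ∎)
        where open ≡-Reasoning

    record LastAtHeight (T d : ℕ) : Set where
      field
        σ            : ℕ
        σ≤T          : σ ≤ T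
        height≡      : height σ ≡ d
        higher-after : ∀ r → σ < r → r ≤ T → d < height r

    open LastAtHeight

    lastAtHeight : ∀ T d {t₀} → t₀ ≤ T → height t₀ ≤ d → d ≤ height T → LastAtHeight T d
    lastAtHeight T d {t₀} t₀≤T low high with lastUpTo (λ t → height t ≤? d) T
    ... | inj₁ none = ⊥-elim (none t₀ t₀≤T low)
    ... | inj₂ (σ , σ≤T , σ-low , after) =
            record { σ = σ ; σ≤T = σ≤T ; height≡ = ≤-antisym σ-low d≤σ ; higher-after = higher }
      where
      higher : ∀ r → σ < r → r ≤ T → d < height r
      higher r σ<r r≤T = ≰⇒> (after r r≤T σ<r)
      d≤σ : d ≤ height σ
      d≤σ with m≤n⇒m<n∨m≡n σ≤T
      ... | inj₂ refl = high
      ... | inj₁ σ<T  = s≤s⁻¹ (≤-trans (higher (suc σ) ≤-refl σ<T) (length-step (R σ)))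

    σ-mono : ∀ {T d d'} (ℓ : LastAtHeight T d) (ℓ' : LastAtHeight T d') → d ≤ d' → σ ℓ ≤ σ ℓ'
    σ-mono ℓ ℓ' d≤d' with σ ℓ ≤? σ ℓ'
    ... | yes σ≤σ' = σ≤σ'
    ... | no  σ≰σ' =
          ⊥-elim (<⇒≱ (higher-after ℓ' (σ ℓ) (≰⇒> σ≰σ') (σ≤T ℓ)) (≤-trans (≤-reflexive (height≡ ℓ)) d≤d'))

    higher-than-σ : ∀ {T d} (ℓ : LastAtHeight T d) {t} → σ ℓ ≤ t → t ≤ T →
      ∀ r → 0 < r → r ≤ t ∸ σ ℓ → height (σ ℓ) < height (σ ℓ + r)
    higher-than-σ {T} ℓ σ≤t t≤T r 0<r r≤ = subst (_< height (σ ℓ + r)) (sym (height≡ ℓ))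
      (higher-after ℓ (σ ℓ + r) (m<m+n (σ ℓ) 0<r)
        (≤-trans (+-monoʳ-≤ (σ ℓ) r≤) (subst (_≤ T) (sym (m+[n∸m]≡n σ≤t)) t≤T)))

    prefix-until : ∀ {T d} (ℓ : LastAtHeight T d) t → σ ℓ ≤ t → t ≤ T → word (σ ℓ) ≼ word t
    prefix-until ℓ t σ≤t t≤T = subst (λ t → word (σ ℓ) ≼ word t) (m+[n∸m]≡n σ≤t)
      (prefix-persists (σ ℓ) (t ∸ σ ℓ) ([] , sym (++-identityʳ _)) (higher-than-σ ℓ σ≤t t≤T))

    -- The run never reads below word s and returns to the same state and top symbol, so these P steps repeat for ever.
    record Pump : Set where
      field
        s P        : ℕ
        y          : Word
        y-nonempty : 0 < length y
        returns    : R (s + P) ≡ (state s , word s ++ y)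
        top        : rightmost (word s ++ y) ≡ rightmost (word s)
        above      : ∀ r → 0 < r → r ≤ P → height s < height (s + r)

    pump-between : ∀ {T d d'} (ℓ : LastAtHeight T d) (ℓ' : LastAtHeight T d') → d < d' →
      state (σ ℓ) ≡ state (σ ℓ') → rightmost (word (σ ℓ)) ≡ rightmost (word (σ ℓ')) → Pump
    pump-between {d = d} {d'} ℓ ℓ' d<d' same-state same-top = record
      { s          = σ ℓ
      ; P          = σ ℓ' ∸ σ ℓ
      ; y          = y
      ; y-nonempty = +-cancelˡ-< d 0 (length y) (subst₂ _<_ (sym (+-identityʳ d)) lengths d<d')
      ; returns    = trans (cong R (m+[n∸m]≡n σ≤σ')) (cong₂ _,_ (sym same-state) word≡)
      ; top        = trans (cong rightmost (sym word≡)) (sym same-top)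
      ; above      = higher-than-σ ℓ σ≤σ' (σ≤T ℓ')
      }
      where
      σ≤σ' = σ-mono ℓ ℓ' (<⇒≤ d<d')
      y = proj₁ (prefix-until ℓ (σ ℓ') σ≤σ' (σ≤T ℓ'))
      word≡ : word (σ ℓ') ≡ word (σ ℓ) ++ y
      word≡ = proj₂ (prefix-until ℓ (σ ℓ') σ≤σ' (σ≤T ℓ'))
      lengths : d' ≡ d + length y
      lengths = begin
        d'                            ≡⟨ height≡ ℓ' ⟨
        length (word (σ ℓ'))          ≡⟨ cong length word≡ ⟩
        length (word (σ ℓ) ++ y)      ≡⟨ length-++ (word (σ ℓ)) ⟩
        length (word (σ ℓ)) + length y ≡⟨ cong (_+ length y) (height≡ ℓ) ⟩
        d + length y                  ∎
        where open ≡-Reasoning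

    module Pumping (p : Pump) where
      open Pump p

      u : Word
      u = word s

      pumped : ℕ → Word
      pumped zero    = u
      pumped (suc m) = pumped m ++ y

      pumped-top : ∀ m → rightmost (pumped m) ≡ rightmost u
      pumped-top zero    = refl
      pumped-top (suc m) = trans (rightmost-++ (pumped m) u y (pumped-top m)) top

      prefix-pumped : ∀ m → u ≼ pumped m
      prefix-pumped zero    = [] , sym (++-identityʳ u)
      prefix-pumped (suc m) = ≼-trans (prefix-pumped m) (y , refl)

      length-pumped : ∀ m → m ≤ length (pumped m)
      length-pumped zero    = z≤n
      length-pumped (suc m) =
        subst₂ _≤_ (+-comm m 1) (sym (length-++ (pumped m))) (+-mono-≤ (length-pumped m) y-nonempty)

      run-within-period : ∀ r → r ≤ P →
        ∃₂ λ q z → ∀ v → rightmost v ≡ rightmost u → run M (state s , v) r ≡ (q , v ++ z)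
      run-within-period r r≤P with run-above r (state s) u [] higher
        where
        higher : ∀ r' → 0 < r' → r' ≤ r → length u < length (proj₂ (run M (state s , u ++ []) r'))
        higher r' 0<r' r'≤r = subst (λ c → length u < length (proj₂ c)) (run-from s r' (sym (++-identityʳ u)))
                                (above r' 0<r' (≤-trans r'≤r r≤P))
      ... | q , z , run≡ = q , z , λ v top →
        subst (λ w → run M (state s , w) r ≡ (q , v ++ z)) (++-identityʳ v) (run≡ v top)

      at-period : ∀ m → R (s + m * P) ≡ (state s , pumped m)
      at-period zero    = cong R (+-identityʳ s)
      at-period (suc m) with run-within-period P ≤-refl
      ... | q , z , run≡ = begin
          R (s + (P + m * P))            ≡⟨ cong (λ n → R (s + n)) (+-comm P (m * P)) ⟩
          R (s + (m * P + P))            ≡⟨ cong R (+-assoc s (m * P) P) ⟨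
          R (s + m * P + P)              ≡⟨ run-+ c₀ (s + m * P) P ⟩
          run M (R (s + m * P)) P        ≡⟨ cong (λ c → run M c P) (at-period m) ⟩
          run M (state s , pumped m) P   ≡⟨ run≡ (pumped m) (pumped-top m) ⟩
          (q , pumped m ++ z)            ≡⟨ cong₂ (λ q z → q , pumped m ++ z) q≡ z≡ ⟩
          (state s , pumped m ++ y)      ∎
        where
        open ≡-Reasoning
        one-period : (q , u ++ z) ≡ (state s , u ++ y)
        one-period = trans (sym (run≡ u refl)) (trans (sym (run-+ c₀ s P)) returns)
        q≡ : q ≡ state s
        q≡ = cong proj₁ one-period
        z≡ : z ≡ y
        z≡ = ++-cancelˡ u z y (cong proj₂ one-period)

      P≢0 : P ≢ 0
      P≢0 P≡0 = <⇒≢ y-nonempty (sym (cong length (++-identityʳ-unique u (cong proj₂ (begin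
          R s                 ≡⟨ cong R (+-identityʳ s) ⟨
          R (s + 0)           ≡⟨ cong (λ P → R (s + P)) P≡0 ⟨
          R (s + P)           ≡⟨ returns ⟩
          (state s , u ++ y)  ∎)))))
        where open ≡-Reasoning

      instance
        P-nonZero : NonZero P
        P-nonZero = ≢-nonZero P≢0

      unfold : ∀ x → ∃₂ λ m z → word (s + x) ≡ pumped m ++ z × x < suc m * P
      unfold x with run-within-period (x % P) (<⇒≤ (m%n<n x P))
      ... | q , z , run≡ = x / P , z , cong proj₂ R≡ , x<
        where
        open ≡-Reasoning
        R≡ : R (s + x) ≡ (q , pumped (x / P) ++ z)
        R≡ = begin
          R (s + x)                                 ≡⟨ cong (λ x → R (s + x)) x≡ ⟩
          R (s + (x / P * P + x % P))               ≡⟨ cong R (+-assoc s (x / P * P) (x % P)) ⟨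
          R (s + x / P * P + x % P)                 ≡⟨ run-+ c₀ (s + x / P * P) (x % P) ⟩
          run M (R (s + x / P * P)) (x % P)         ≡⟨ cong (λ c → run M c (x % P)) (at-period (x / P)) ⟩
          run M (state s , pumped (x / P)) (x % P)  ≡⟨ run≡ (pumped (x / P)) (pumped-top (x / P)) ⟩
          (q , pumped (x / P) ++ z)                 ∎
          where
          x≡ : x ≡ x / P * P + x % P
          x≡ = trans (m≡m%n+[m/n]*n x P) (+-comm (x % P) (x / P * P))
        x< : x < suc (x / P) * P
        x< = subst (_< P + x / P * P) (sym (m≡m%n+[m/n]*n x P)) (+-monoˡ-< (x / P * P) (m%n<n x P))

      prefix-forever : ∀ t → s ≤ t → u ≼ word t
      prefix-forever t s≤t with unfold (t ∸ s)
      ... | m , z , word≡ , _ =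
        subst (λ t → u ≼ word t) (m+[n∸m]≡n s≤t) (≼-trans (prefix-pumped m) (z , word≡))

      visit-bound : ∀ t → t < s + suc (height t) * P
      visit-bound t with s ≤? t
      ... | no  s≰t = ≤-trans (≰⇒> s≰t) (m≤m+n s _)
      ... | yes s≤t with unfold (t ∸ s)
      ...   | m , z , word≡ , x< = subst (λ t → t < s + suc (height t) * P) (m+[n∸m]≡n s≤t)
                                     (<-≤-trans (+-monoʳ-< s x<) (+-monoʳ-≤ s (*-monoˡ-≤ P (s≤s m≤height))))
        where
        m≤height : m ≤ height (s + (t ∸ s))
        m≤height = ≤-trans (length-pumped m)
                     (subst (length (pumped m) ≤_) (cong length (sym word≡)) (length-++-≤ˡ (pumped m)))

    -- Pigeonhole on the codes of the last visits of the heights b, …, b + n before T.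
    pump-from-climb : ∀ T b n {t₀} (code : Config k → ℕ) → (∀ c → code c < n) →
      (∀ t t' → b ≤ height t → b ≤ height t' → word t ≼ word T → word t' ≼ word T →
        code (R t) ≡ code (R t') → state t ≡ state t' × rightmost (word t) ≡ rightmost (word t')) →
      t₀ ≤ T → height t₀ ≤ b → b + n ≤ height T →
      ∃ λ (p : Pump) → b ≤ height (Pump.s p) × word (Pump.s p) ≼ word T
    pump-from-climb T b n code code<n agree t₀≤T low high =
      collide (pigeonhole-ℕ n (λ i → code (R (σ (ℓ i)))) (λ _ → code<n _))
      where
      ℓ : (i : Fin (suc n)) → LastAtHeight T (b + toℕ i)
      ℓ i = lastAtHeight T (b + toℕ i) t₀≤T (≤-trans low (m≤m+n b _))
              (≤-trans (+-monoʳ-≤ b (s≤s⁻¹ (toℕ<n i))) high)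
      b≤ : ∀ i → b ≤ height (σ (ℓ i))
      b≤ i = ≤-trans (m≤m+n b (toℕ i)) (≤-reflexive (sym (height≡ (ℓ i))))
      prefix-T : ∀ i → word (σ (ℓ i)) ≼ word T
      prefix-T i = prefix-until (ℓ i) T (σ≤T (ℓ i)) ≤-refl
      collide : (∃₂ λ i j → i Fin.< j × code (R (σ (ℓ i))) ≡ code (R (σ (ℓ j)))) →
        ∃ λ (p : Pump) → b ≤ height (Pump.s p) × word (Pump.s p) ≼ word T
      collide (i , j , i<j , codes≡) with agree (σ (ℓ i)) (σ (ℓ j)) (b≤ i) (b≤ j) (prefix-T i) (prefix-T j) codes≡
      ... | same-state , same-top =
        pump-between (ℓ i) (ℓ j) (+-monoʳ-< b i<j) same-state same-top , b≤ i , prefix-T i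

    VisitsBoundedBy : (Word → ℕ) → Set
    VisitsBoundedBy B = ∀ t → ∃ λ t' → t' ≤ B (word t) × word t' ≡ word t

    pump-bounded : Pump → ∃ VisitsBoundedBy
    pump-bounded p =
      (λ w → Pump.s p + suc (length w) * Pump.P p) , λ t → t , <⇒≤ (Pumping.visit-bound p t) , refl

    repetition-bounded : ∀ {s t} → s < t → R s ≡ R t → ∃ VisitsBoundedBy
    repetition-bounded {t = t} s<t Rs≡Rt = (λ _ → t) , λ x →
      let (x' , x'<t , Rx≡Rx') = repetition-bound s<t Rs≡Rt x in x' , <⇒≤ x'<t , cong proj₂ (sym Rx≡Rx')

    bounded-if-high : ∀ T → height 0 + k * 3 ≤ height T → ∃ VisitsBoundedBy
    bounded-if-high T high =
      let (p , _) = pump-from-climb T (height 0) (k * 3) {0} topCode topCode<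
                      (λ t t' _ _ _ _ → topCode-injective (R t) (R t')) z≤n ≤-refl high
      in pump-bounded p

    bounded-if-short : ∀ H → (∀ t → t ≤ 2 ^ H * k → height t < H) → ∃ VisitsBoundedBy
    bounded-if-short H short with pigeonhole-ℕ (2 ^ H * k) (λ i → configCode (R (toℕ i)))
                                   (λ i → configCode< H (R (toℕ i)) (short (toℕ i) (s≤s⁻¹ (toℕ<n i))))
    ... | i , j , i<j , codes≡ = repetition-bounded i<j (configCode-injective (R (toℕ i)) (R (toℕ j)) codes≡)

    visits-bounded : ∃ VisitsBoundedBy
    visits-bounded with lastUpTo (λ t → height 0 + k * 3 ≤? height t) (2 ^ (height 0 + k * 3) * k)
    ... | inj₂ (T , _ , high , _) = bounded-if-high T high
    ... | inj₁ low                = bounded-if-short (height 0 + k * 3) (λ t t≤N → ≰⇒> (low t t≤N))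

    visited? : ∀ w → Dec (Visited M c₀ w)
    visited? w with visits-bounded
    ... | B , bounded with lastUpTo (λ t → ≡-dec _≟ᵇ_ (word t) w) (B w)
    ...   | inj₂ (t , _ , word≡ , _) = yes (t , word≡)
    ...   | inj₁ none = no λ { (t , refl) → let (t' , t'≤ , word≡) = bounded t in none t' t'≤ word≡ }

rightmost-∷-constant : ∀ {c} x w → All (_≡ c) w → w ≢ [] → rightmost (x ∷ w) ≡ bit c
rightmost-∷-constant x w all≡c w≢[] with initLast w
... | []       = ⊥-elim (w≢[] refl)
... | ws ∷ʳ′ b = cong bit (proj₂ (∷ʳ⁻ all≡c))

candidate : ℕ → Bit → Word
candidate k c = b1 ∷ c ∷ List.replicate k c

length-candidate : ∀ k c → length (candidate k c) ≡ k + 2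
length-candidate k c = trans (cong (2 +_) (length-replicate k)) (+-comm 2 k)

prefix-of-candidate : ∀ {k c} u → u ≼ candidate k c → 2 ≤ length u → rightmost u ≡ bit c × b1 ∷ c ∷ [] ≼ u
prefix-of-candidate []           _        ()
prefix-of-candidate (_ ∷ [])     _        (s≤s ())
prefix-of-candidate {k} {c} (x ∷ y ∷ v) (z , eq) _ with ∷-injective eq
... | refl , eq' with ∷-injective eq'
...   | refl , _ = rightmost-∷-constant b1 (c ∷ v) all≡c (λ ()) , v , refl
  where
  all≡c : All (_≡ c) (c ∷ v)
  all≡c = ++⁻ˡ (c ∷ v) (subst (All (_≡ c)) eq' (replicate⁺ (suc k) refl))

module _ {k : ℕ} (M : StackMachine k) where

  initial : Config k
  initial = StackMachine.qi M , toList (replicate (k + 2) b0)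

  open Run M initial

  initial-prefix : b0 ∷ [] ≼ word 0
  initial-prefix =
    List.replicate (suc k) b0 , trans (toList-replicate (k + 2) b0) (cong (λ n → List.replicate n b0) (+-comm k 2))

  low-before-candidate : ∀ {c T} → word T ≡ candidate k c → ∃ λ t₀ → t₀ ≤ T × height t₀ ≤ 1
  low-before-candidate {c} {T} word≡ with lastUpTo (λ t → height t ≤? 1) T
  ... | inj₂ (t₀ , t₀≤T , low , _) = t₀ , t₀≤T , low
  ... | inj₁ high with prefix-persists 0 T initial-prefix (λ r _ r≤T → ≰⇒> (high r r≤T))
  ...   | _ , word≡' with trans (sym word≡) word≡'
  ...     | ()

  candidate-locks-prefix : ∀ c → Visited M initial (candidate k c) →
    ∃ λ s → ∀ t → s ≤ t → b1 ∷ c ∷ [] ≼ word t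
  candidate-locks-prefix c (T , word≡) =
    let (t₀ , t₀≤T , low) = low-before-candidate word≡
        (p , 2≤ , prefix) = pump-from-climb T 2 k (toℕ ∘ proj₁) (toℕ<n ∘ proj₁) agree t₀≤T (m≤n⇒m≤1+n low) tall
        s = Pump.s p
    in s , λ t s≤t → ≼-trans (proj₂ (prefix-of-candidate (word s) (subst (word s ≼_) word≡ prefix) 2≤))
                             (Pumping.prefix-forever p t s≤t)
    where
    top≡c : ∀ t → 2 ≤ height t → word t ≼ word T → rightmost (word t) ≡ bit c
    top≡c t 2≤ prefix = proj₁ (prefix-of-candidate (word t) (subst (word t ≼_) word≡ prefix) 2≤)
    agree : ∀ t t' → 2 ≤ height t → 2 ≤ height t' → word t ≼ word T → word t' ≼ word T →
      toℕ (state t) ≡ toℕ (state t') → state t ≡ state t' × rightmost (word t) ≡ rightmost (word t')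
    agree t t' 2≤ 2≤' prefix prefix' states≡ =
      toℕ-injective states≡ , trans (top≡c t 2≤ prefix) (sym (top≡c t' 2≤' prefix'))
    tall : 2 + k ≤ height T
    tall = ≤-reflexive (sym (trans (cong length word≡) (cong (2 +_) (length-replicate k))))

  not-both-visited : Visited M initial (candidate k b1) → ¬ Visited M initial (candidate k b0)
  not-both-visited visited₁ visited₀ =
    let (s₁ , locked₁) = candidate-locks-prefix b1 visited₁
        (s₀ , locked₀) = candidate-locks-prefix b0 visited₀
        (_ , word≡₁)   = locked₁ (s₁ + s₀) (m≤m+n s₁ s₀)
        (_ , word≡₀)   = locked₀ (s₁ + s₀) (m≤n+m s₀ s₁)
    in b1≢b0 (∷-injectiveˡ (∷-injectiveʳ (trans (sym word≡₁) word≡₀)))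
    where
    b1≢b0 : b1 ≢ b0
    b1≢b0 ()

  unvisited-vector : ∀ {w n} → ¬ Visited M initial w → length w ≡ n →
    ∃ λ (v : Vec Bit n) → ¬ Visited M initial (toList v)
  unvisited-vector {w} ¬visited refl =
    fromList w , subst (λ w → ¬ Visited M initial w) (sym (toList∘fromList w)) ¬visited

proposition17 : (k : ℕ) (M : StackMachine k) →
    ∃ λ (w : Vec Bit (k + 2)) →
      ¬ Visited M (StackMachine.qi M , toList (replicate (k + 2) b0)) (toList w)
proposition17 k M with Run.visited? M (initial M) (candidate k b1)
... | no  ¬visited₁ = unvisited-vector M ¬visited₁ (length-candidate k b1)
... | yes visited₁  = unvisited-vector M (not-both-visited M visited₁) (length-candidate k b0)
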